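{- Let $\delta=1/4$. Let $G$ be a bipartite graph on vertex classes $X$ and $Y$, each of size $n$, with edge density $d=d_{X,Y}>0$. Then at least one of the following holds: (i) there exist nonempty proper subsets $X'\subsetneq X$ and $Y'\subsetneq Y$ with $|X'|=|Y'|$ and $\frac{d_{X',Y'}}{d}\geq \left(\frac{n}{|Y'|}\right)^{\delta}$; (ii) for every $A\subseteq X$ and $B\subseteq Y$ we have $kn+e(A,B)\geq k|A|+k|B|$, where $k=dn/100$.
   Context: For vertex sets $A,B$, $e(A,B)$ is the number of edges between $A$ and $B$, and $d_{A,B}=\frac{e(A,B)}{|A||B|}$ is the edge density between them. -}

module Defs where

open import Data.Bool using (Bool; true; false; _∧_)
open import Data.Nat using (ℕ; zero; suc; _*_)
open import Data.Fin using (Fin)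
open import Data.Fin.Subset using (Subset)
open import Data.List using (List; map; allFin)
open import Data.Nat.ListAction using (sum)
open import Data.Vec using (lookup)
open import Data.Integer using (+_)
open import Data.Rational using (ℚ; _/_; 0ℚ; 1ℚ) renaming (_*_ to _*ℚ_)

-- A bipartite graph with vertex classes X = Fin n and Y = Fin n:
-- adj x y = true iff x ∈ X and y ∈ Y are adjacent.
BipGraph : ℕ → Set
BipGraph n = Fin n → Fin n → Bool

boolToℕ : Bool → ℕ
boolToℕ true  = 1
boolToℕ false = 0

e : ∀ {n} → BipGraph n → Subset n → Subset n → ℕ
e {n} G A B =
  sum (map (λ x → sum (map (λ y → boolToℕ (lookup A x ∧ lookup B y ∧ G x y)) (allFin n))) (allFin n))

-- a / b as a rational, with the (never used) convention a / 0 = 0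
ratio : ℕ → ℕ → ℚ
ratio a zero    = 0ℚ
ratio a (suc b) = (+ a) / suc b

-- edge density d_{A,B} = e(A,B) / (|A||B|)  (convention: 0 if A or B is empty)
dens : ∀ {n} → BipGraph n → Subset n → Subset n → ℚ
dens G A B = ratio (e G A B) (Data.Fin.Subset.∣ A ∣ * Data.Fin.Subset.∣ B ∣)

_^ℚ_ : ℚ → ℕ → ℚ
q ^ℚ zero  = 1ℚ
q ^ℚ suc k = q *ℚ (q ^ℚ k)

ℕtoℚ : ℕ → ℚ
ℕtoℚ m = (+ m) / 1

module Submission where

-- Write D = e(X,Y). If (i) fails, every pair X′, Y′ of equal size m with 0 < m < n has
-- e(X′,Y′)⁴ n⁷ < D⁴ m⁷. Averaging over the columns of a larger set Y, together with
-- AM–GM in the form 4 n^(1/4) m^(3/4) ≤ n + 3m, turns this into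
-- 4 n² e(X′,Y) ≤ D |Y| (n + 3|X′|) whenever |X′| < n and |X′| ≤ |Y|.
-- Now let A ⊆ X, B ⊆ Y violate (ii); after transposing the graph we may assume |X∖A| ≤ |Y∖B|.
-- Split D = e(A,B) + e(X∖A,B) + e(X,Y∖B): the violation bounds the first term and the estimate
-- above the other two, and the three bounds add up to less than D.

module Fraction where

  open import Data.Nat as ℕ using (ℕ; zero; suc; NonZero)
  open import Data.Nat.Properties as ℕ using (m*n≢0; m^n≢0)
  open import Data.Nat.Solver using (module +-*-Solver)
  open import Data.Integer as ℤ using (+_)
  open import Data.Integer.Properties as ℤ using (pos-*; pos-+)
  open import Data.Rational using (ℚ; _≤_; _*_; _+_; _/_; toℚᵘ)
  open import Data.Rational.Properties using (toℚᵘ-injective; toℚᵘ-fromℚᵘ; toℚᵘ-homo-*; toℚᵘ-homo-+; toℚᵘ-cancel-≤)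
  open import Data.Rational.Unnormalised as ℚᵘ using (mkℚᵘ; *≤*)
  open import Data.Rational.Unnormalised.Properties as ℚᵘ using (≃-sym; module ≃-Reasoning)
  open import Relation.Binary.PropositionalEquality
  open import Defs using (_^ℚ_; ratio; ℕtoℚ)

  infixl 7 _÷_

  _÷_ : ℕ → (q : ℕ) → .{{NonZero q}} → ℚ
  p ÷ q = (+ p) / q

  toℚᵘ-÷ : ∀ p q → toℚᵘ (p ÷ suc q) ℚᵘ.≃ mkℚᵘ (+ p) q
  toℚᵘ-÷ p q = toℚᵘ-fromℚᵘ (mkℚᵘ (+ p) q)

  ÷-* : ∀ p q r s .{{_ : NonZero q}} .{{_ : NonZero s}} →
        p ÷ q * (r ÷ s) ≡ (p ℕ.* r ÷ (q ℕ.* s)) {{m*n≢0 q s}}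
  ÷-* p (suc q) r (suc s) = toℚᵘ-injective (begin
    toℚᵘ (p ÷ suc q * (r ÷ suc s))          ≈⟨ toℚᵘ-homo-* (p ÷ suc q) (r ÷ suc s) ⟩
    toℚᵘ (p ÷ suc q) ℚᵘ.* toℚᵘ (r ÷ suc s)  ≈⟨ ℚᵘ.*-cong (toℚᵘ-÷ p q) (toℚᵘ-÷ r s) ⟩
    mkℚᵘ (+ p ℤ.* + r) _                    ≡⟨ cong (λ z → mkℚᵘ z _) (sym (pos-* p r)) ⟩
    mkℚᵘ (+ (p ℕ.* r)) _                    ≈⟨ ≃-sym (toℚᵘ-÷ (p ℕ.* r) _) ⟩
    toℚᵘ (p ℕ.* r ÷ (suc q ℕ.* suc s))      ∎)
    where open ≃-Reasoning

  ÷-+ : ∀ p q r s .{{_ : NonZero q}} .{{_ : NonZero s}} →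
        p ÷ q + r ÷ s ≡ ((p ℕ.* s ℕ.+ r ℕ.* q) ÷ (q ℕ.* s)) {{m*n≢0 q s}}
  ÷-+ p (suc q) r (suc s) = toℚᵘ-injective (begin
    toℚᵘ (p ÷ suc q + r ÷ suc s)                       ≈⟨ toℚᵘ-homo-+ (p ÷ suc q) (r ÷ suc s) ⟩
    toℚᵘ (p ÷ suc q) ℚᵘ.+ toℚᵘ (r ÷ suc s)             ≈⟨ ℚᵘ.+-cong (toℚᵘ-÷ p q) (toℚᵘ-÷ r s) ⟩
    mkℚᵘ (+ p ℤ.* + suc s ℤ.+ + r ℤ.* + suc q) _       ≡⟨ cong (λ z → mkℚᵘ z _) numerator ⟩
    mkℚᵘ (+ (p ℕ.* suc s ℕ.+ r ℕ.* suc q)) _           ≈⟨ ≃-sym (toℚᵘ-÷ _ _) ⟩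
    toℚᵘ ((p ℕ.* suc s ℕ.+ r ℕ.* suc q) ÷ (suc q ℕ.* suc s)) ∎)
    where
    open ≃-Reasoning
    numerator : + p ℤ.* + suc s ℤ.+ + r ℤ.* + suc q ≡ + (p ℕ.* suc s ℕ.+ r ℕ.* suc q)
    numerator = trans (cong₂ ℤ._+_ (sym (pos-* p (suc s))) (sym (pos-* r (suc q))))
                      (sym (pos-+ (p ℕ.* suc s) (r ℕ.* suc q)))

  ÷-^ : ∀ p q k .{{_ : NonZero q}} → (p ÷ q) ^ℚ k ≡ (p ℕ.^ k ÷ q ℕ.^ k) {{m^n≢0 q k}}
  ÷-^ p q zero    = refl
  ÷-^ p q (suc k) {{q≢0}} = trans (cong (p ÷ q *_) (÷-^ p q k)) (÷-* p q (p ℕ.^ k) (q ℕ.^ k) {{q≢0}} {{m^n≢0 q k}})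

  ÷-mono-≤ : ∀ p q r s .{{_ : NonZero q}} .{{_ : NonZero s}} → p ℕ.* s ℕ.≤ r ℕ.* q → p ÷ q ≤ r ÷ s
  ÷-mono-≤ p (suc q) r (suc s) ps≤rq = toℚᵘ-cancel-≤
    (ℚᵘ.≤-respˡ-≃ (≃-sym (toℚᵘ-÷ p q)) (ℚᵘ.≤-respʳ-≃ (≃-sym (toℚᵘ-÷ r s))
      (*≤* (subst₂ ℤ._≤_ (pos-* p (suc s)) (pos-* r (suc q)) (ℤ.+≤+ ps≤rq)))))

  ratio-power-≤ : ∀ n m D E .{{_ : NonZero n}} .{{_ : NonZero m}} →
    D ℕ.^ 4 ℕ.* m ℕ.^ 7 ℕ.≤ E ℕ.^ 4 ℕ.* n ℕ.^ 7 →
    ratio D (n ℕ.* n) ^ℚ 4 * ratio n m ≤ ratio E (m ℕ.* m) ^ℚ 4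
  ratio-power-≤ n@(suc _) m@(suc _) D E D⁴m⁷≤E⁴n⁷ = subst₂ _≤_ (sym lhs) (sym rhs)
    (÷-mono-≤ (D ℕ.^ 4 ℕ.* n) ((n ℕ.* n) ℕ.^ 4 ℕ.* m) (E ℕ.^ 4) ((m ℕ.* m) ℕ.^ 4) cross)
    where
    open +-*-Solver
    lhs : (D ÷ (n ℕ.* n)) ^ℚ 4 * (n ÷ m) ≡ D ℕ.^ 4 ℕ.* n ÷ ((n ℕ.* n) ℕ.^ 4 ℕ.* m)
    lhs = trans (cong (_* (n ÷ m)) (÷-^ D (n ℕ.* n) 4)) (÷-* (D ℕ.^ 4) ((n ℕ.* n) ℕ.^ 4) n m)
    rhs : (E ÷ (m ℕ.* m)) ^ℚ 4 ≡ E ℕ.^ 4 ÷ (m ℕ.* m) ℕ.^ 4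
    rhs = ÷-^ E (m ℕ.* m) 4
    cross : D ℕ.^ 4 ℕ.* n ℕ.* (m ℕ.* m) ℕ.^ 4 ℕ.≤ E ℕ.^ 4 ℕ.* ((n ℕ.* n) ℕ.^ 4 ℕ.* m)
    cross = subst₂ ℕ._≤_
      (solve 3 (λ n m D → (n :* m) :* (D :^ 4 :* m :^ 7) := D :^ 4 :* n :* (m :* m) :^ 4) refl n m D)
      (solve 3 (λ n m E → (n :* m) :* (E :^ 4 :* n :^ 7) := E :^ 4 :* ((n :* n) :^ 4 :* m)) refl n m E)
      (ℕ.*-monoʳ-≤ (n ℕ.* m) D⁴m⁷≤E⁴n⁷)

  ratio-expansion-≤ : ∀ {d} n D E a b .{{_ : NonZero n}} → d ≡ ratio D (n ℕ.* n) →
    D ℕ.* (a ℕ.+ b) ℕ.≤ 100 ℕ.* n ℕ.* E ℕ.+ D ℕ.* n →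
    d * ((+ n) / 100) * ℕtoℚ a + d * ((+ n) / 100) * ℕtoℚ b ≤ d * ((+ n) / 100) * ℕtoℚ n + ℕtoℚ E
  ratio-expansion-≤ n@(suc _) D E a b refl expanding = subst₂ _≤_ (sym lhs) (sym rhs)
    (÷-mono-≤ (D ℕ.* n ℕ.* a ℕ.* (q ℕ.* 1) ℕ.+ D ℕ.* n ℕ.* b ℕ.* (q ℕ.* 1)) (q ℕ.* 1 ℕ.* (q ℕ.* 1))
              (D ℕ.* n ℕ.* n ℕ.* 1 ℕ.+ E ℕ.* (q ℕ.* 1)) (q ℕ.* 1 ℕ.* 1) cross)
    where
    q = n ℕ.* n ℕ.* 100
    k : D ÷ (n ℕ.* n) * (n ÷ 100) ≡ D ℕ.* n ÷ q
    k = ÷-* D (n ℕ.* n) n 100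
    k* : ∀ x → D ÷ (n ℕ.* n) * (n ÷ 100) * (x ÷ 1) ≡ D ℕ.* n ℕ.* x ÷ (q ℕ.* 1)
    k* x = trans (cong (_* (x ÷ 1)) k) (÷-* (D ℕ.* n) q x 1)
    lhs : D ÷ (n ℕ.* n) * (n ÷ 100) * (a ÷ 1) + D ÷ (n ℕ.* n) * (n ÷ 100) * (b ÷ 1)
        ≡ (D ℕ.* n ℕ.* a ℕ.* (q ℕ.* 1) ℕ.+ D ℕ.* n ℕ.* b ℕ.* (q ℕ.* 1)) ÷ (q ℕ.* 1 ℕ.* (q ℕ.* 1))
    lhs = trans (cong₂ _+_ (k* a) (k* b)) (÷-+ (D ℕ.* n ℕ.* a) (q ℕ.* 1) (D ℕ.* n ℕ.* b) (q ℕ.* 1))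
    rhs : D ÷ (n ℕ.* n) * (n ÷ 100) * (n ÷ 1) + E ÷ 1
        ≡ (D ℕ.* n ℕ.* n ℕ.* 1 ℕ.+ E ℕ.* (q ℕ.* 1)) ÷ (q ℕ.* 1 ℕ.* 1)
    rhs = trans (cong (_+ E ÷ 1) (k* n)) (÷-+ (D ℕ.* n ℕ.* n) (q ℕ.* 1) E 1)
    cross : (D ℕ.* n ℕ.* a ℕ.* (q ℕ.* 1) ℕ.+ D ℕ.* n ℕ.* b ℕ.* (q ℕ.* 1)) ℕ.* (q ℕ.* 1 ℕ.* 1)
        ℕ.≤ (D ℕ.* n ℕ.* n ℕ.* 1 ℕ.+ E ℕ.* (q ℕ.* 1)) ℕ.* (q ℕ.* 1 ℕ.* (q ℕ.* 1))
    cross = subst₂ ℕ._≤_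
      (solve 4 (λ n D a b → n :* Q n :* Q n :* (D :* (a :+ b))
                        := (D :* n :* a :* (Q n :* con 1) :+ D :* n :* b :* (Q n :* con 1)) :* (Q n :* con 1 :* con 1))
             refl n D a b)
      (solve 3 (λ n D E → n :* Q n :* Q n :* (con 100 :* n :* E :+ D :* n)
                        := (D :* n :* n :* con 1 :+ E :* (Q n :* con 1)) :* (Q n :* con 1 :* (Q n :* con 1)))
             refl n D E)
      (ℕ.*-monoʳ-≤ (n ℕ.* q ℕ.* q) expanding)
      where
      open +-*-Solver
      Q : ∀ {k} → Polynomial k → Polynomial k
      Q n = n :* n :* con 100

module NatInequalities where

  open import Data.Nat
  open import Data.Nat.Properties
  open import Data.Nat.Solver using (module +-*-Solver)
  open import Data.Product using (_,_)
  open import Data.Sum using (inj₁; inj₂)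
  open import Data.Empty using (⊥)
  open import Relation.Nullary using (yes; no; contradiction)
  open import Relation.Binary.PropositionalEquality

  ^-cancelˡ-≤ : ∀ k .{{_ : NonZero k}} {x y} → x ^ k ≤ y ^ k → x ≤ y
  ^-cancelˡ-≤ k {x} {y} xᵏ≤yᵏ with x ≤? y
  ... | yes x≤y = x≤y
  ... | no  x≰y = contradiction (^-monoˡ-< k (≰⇒> x≰y)) (≤⇒≯ xᵏ≤yᵏ)

  -- In both cases (n + 3m)⁴ − 256 n m³ = u² · (positive quadratic), where u = |n − m|.
  am-gm₄ : ∀ n m → 256 * n * m ^ 3 ≤ (n + 3 * m) ^ 4
  am-gm₄ n m with ≤-total m n
  ... | inj₁ m≤n with m≤n⇒∃[o]m+o≡n m≤n
  ...   | u , refl = ≤-trans (m≤m+n _ _) (≤-reflexive (sym (solve 2 (λ m u →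
            (m :+ u :+ con 3 :* m) :^ 4
              := con 256 :* (m :+ u) :* m :^ 3
                 :+ u :* u :* ((m :+ u) :* (m :+ u) :+ con 14 :* (m :+ u) :* m :+ con 81 :* m :* m))
            refl m u)))
    where open +-*-Solver
  am-gm₄ n m | inj₂ n≤m with m≤n⇒∃[o]m+o≡n n≤m
  ...   | u , refl = ≤-trans (m≤m+n _ _) (≤-reflexive (sym (solve 2 (λ n u →
            (n :+ con 3 :* (n :+ u)) :^ 4
              := con 256 :* n :* (n :+ u) :^ 3
                 :+ u :* u :* (n :* n :+ con 14 :* n :* (n :+ u) :+ con 81 :* (n :+ u) :* (n :+ u)))
            refl n u)))
    where open +-*-Solver

  -- Over the reals: E ≤ (c/m) E′ ≤ c D m^(3/4) n^(-7/4) ≤ c D (n + 3m) / (4n²), the last step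
  -- being AM–GM in the form n^(1/4) m^(3/4) ≤ (n + 3m)/4; here everything is raised to the fourth power.
  fourth-power-bound : ∀ n m c E E′ D .{{_ : NonZero m}} →
    m * E ≤ c * E′ → E′ ^ 4 * n ^ 7 ≤ D ^ 4 * m ^ 7 → 4 * n * n * E ≤ D * c * (n + 3 * m)
  fourth-power-bound n m c E E′ D mE≤cE′ E′⁴n⁷≤D⁴m⁷ = *-cancelˡ-≤ m (^-cancelˡ-≤ 4 (begin
    (m * (4 * n * n * E)) ^ 4             ≡⟨ solve 3 (λ m n E → (m :* (con 4 :* n :* n :* E)) :^ 4
                                                := con 256 :* n :^ 8 :* (m :* E) :^ 4) refl m n E ⟩
    256 * n ^ 8 * (m * E) ^ 4             ≤⟨ *-monoʳ-≤ (256 * n ^ 8) (^-monoˡ-≤ 4 mE≤cE′) ⟩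
    256 * n ^ 8 * (c * E′) ^ 4            ≡⟨ solve 3 (λ n c E′ → con 256 :* n :^ 8 :* (c :* E′) :^ 4
                                                := con 256 :* n :* c :^ 4 :* (E′ :^ 4 :* n :^ 7)) refl n c E′ ⟩
    256 * n * c ^ 4 * (E′ ^ 4 * n ^ 7)    ≤⟨ *-monoʳ-≤ (256 * n * c ^ 4) E′⁴n⁷≤D⁴m⁷ ⟩
    256 * n * c ^ 4 * (D ^ 4 * m ^ 7)     ≡⟨ solve 4 (λ n m c D → con 256 :* n :* c :^ 4 :* (D :^ 4 :* m :^ 7)
                                                := (m :* c :* D) :^ 4 :* (con 256 :* n :* m :^ 3)) refl n m c D ⟩
    (m * c * D) ^ 4 * (256 * n * m ^ 3)   ≤⟨ *-monoʳ-≤ ((m * c * D) ^ 4) (am-gm₄ n m) ⟩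
    (m * c * D) ^ 4 * (n + 3 * m) ^ 4     ≡⟨ solve 4 (λ n m c D → (m :* c :* D) :^ 4 :* (n :+ con 3 :* m) :^ 4
                                                := (m :* (D :* c :* (n :+ con 3 :* m))) :^ 4) refl n m c D ⟩
    (m * (D * c * (n + 3 * m))) ^ 4       ∎))
    where
    open ≤-Reasoning
    open +-*-Solver

  -- With t = s + u, the right-hand side exceeds the left by 196r² + 292rs + 196ru + 100s² + 200su.
  weights-≤ : ∀ {n} r s t → n ≡ r + s + t → s ≤ t →
    4 * n * r + 100 * (r + s) * (n + 3 * s) + 100 * n * (n + 3 * t) ≤ 400 * n * n
  weights-≤ r s t refl s≤t with m≤n⇒∃[o]m+o≡n s≤t
  ... | u , refl = ≤-trans (m≤m+n _ (196 * r * r + 292 * r * s + 196 * r * u + 100 * s * s + 200 * s * u))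
    (≤-reflexive (solve 3 (λ r s u →
       con 4 :* N r s u :* r :+ con 100 :* (r :+ s) :* (N r s u :+ con 3 :* s)
         :+ con 100 :* N r s u :* (N r s u :+ con 3 :* (s :+ u))
         :+ (con 196 :* r :* r :+ con 292 :* r :* s :+ con 196 :* r :* u :+ con 100 :* s :* s :+ con 200 :* s :* u)
       := con 400 :* N r s u :* N r s u) refl r s u))
    where
    open +-*-Solver
    N : ∀ {k} → Polynomial k → Polynomial k → Polynomial k → Polynomial k
    N r s u = r :+ s :+ (s :+ u)

  -- In the application r = |A| + |B| − n, s = |X∖A|, t = |Y∖B|, and E₀, F, P are the edge counts
  -- e(A,B), e(X∖A,B), e(X,Y∖B), which add up to D = e(X,Y).
  excess-contradiction : ∀ {n D} r s t E₀ F P → n ≡ r + s + t → D ≡ E₀ + F + P → s ≤ t →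
    100 * n * E₀ < D * r → 4 * n * n * F ≤ D * (r + s) * (n + 3 * s) → 4 * n * n * P ≤ D * n * (n + 3 * t) → ⊥
  excess-contradiction {n} {D} zero s t E₀ F P _ _ _ h₀ _ _ = n≮0 (subst (100 * n * E₀ <_) (*-zeroʳ D) h₀)
  excess-contradiction {n} {D} r@(suc _) s t E₀ F P n≡ D≡ s≤t h₀ hF hP = <-irrefl refl (begin-strict
    400 * n * n * D
      ≡⟨ cong (400 * n * n *_) D≡ ⟩
    400 * n * n * (E₀ + F + P)
      ≡⟨ solve 4 (λ n E₀ F P → con 400 :* n :* n :* (E₀ :+ F :+ P)
           := con 4 :* n :* (con 100 :* n :* E₀) :+ con 100 :* (con 4 :* n :* n :* F)
              :+ con 100 :* (con 4 :* n :* n :* P)) refl n E₀ F P ⟩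
    4 * n * (100 * n * E₀) + 100 * (4 * n * n * F) + 100 * (4 * n * n * P)
      <⟨ +-mono-<-≤ (+-mono-<-≤ (*-monoʳ-< (4 * n) {{m*n≢0 4 n}} h₀) (*-monoʳ-≤ 100 hF)) (*-monoʳ-≤ 100 hP) ⟩
    4 * n * (D * r) + 100 * (D * (r + s) * (n + 3 * s)) + 100 * (D * n * (n + 3 * t))
      ≡⟨ solve 5 (λ n D r s t → con 4 :* n :* (D :* r) :+ con 100 :* (D :* (r :+ s) :* (n :+ con 3 :* s))
                                 :+ con 100 :* (D :* n :* (n :+ con 3 :* t))
           := D :* (con 4 :* n :* r :+ con 100 :* (r :+ s) :* (n :+ con 3 :* s) :+ con 100 :* n :* (n :+ con 3 :* t)))
           refl n D r s t ⟩
    D * (4 * n * r + 100 * (r + s) * (n + 3 * s) + 100 * n * (n + 3 * t))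
      ≤⟨ *-monoʳ-≤ D (weights-≤ r s t n≡ s≤t) ⟩
    D * (400 * n * n)
      ≡⟨ *-comm D _ ⟩
    400 * n * n * D ∎)
    where
    open ≤-Reasoning
    open +-*-Solver
    instance
      n≢0 : NonZero n
      n≢0 = >-nonZero (subst (0 <_) (sym n≡) z<s)

  averaging-keep : ∀ m c x T σ → m < c → T ≤ c * x → m * T ≤ c * σ → suc m * (x + T) ≤ suc c * (x + σ)
  averaging-keep m c x T σ m<c T≤cx mT≤cσ with m≤n⇒∃[o]m+o≡n m<c
  ... | u , refl = *-cancelˡ-≤ (suc m + u) (begin
    c * (suc m * (x + T))
      ≡⟨ solve 4 (λ m u x T → C m u :* ((con 1 :+ m) :* (x :+ T))
           := C m u :* (con 1 :+ m) :* x :+ (con 1 :+ C m u) :* (m :* T) :+ (con 1 :+ u) :* T) refl m u x T ⟩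
    c * suc m * x + suc c * (m * T) + suc u * T
      ≤⟨ +-monoʳ-≤ (c * suc m * x + suc c * (m * T)) (*-monoʳ-≤ (suc u) T≤cx) ⟩
    c * suc m * x + suc c * (m * T) + suc u * (c * x)
      ≡⟨ solve 4 (λ m u x T → C m u :* (con 1 :+ m) :* x :+ (con 1 :+ C m u) :* (m :* T) :+ (con 1 :+ u) :* (C m u :* x)
           := C m u :* (con 1 :+ C m u) :* x :+ (con 1 :+ C m u) :* (m :* T)) refl m u x T ⟩
    c * suc c * x + suc c * (m * T)
      ≤⟨ +-monoʳ-≤ (c * suc c * x) (*-monoʳ-≤ (suc c) mT≤cσ) ⟩
    c * suc c * x + suc c * (c * σ)
      ≡⟨ solve 3 (λ c x σ → c :* (con 1 :+ c) :* x :+ (con 1 :+ c) :* (c :* σ)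
           := c :* ((con 1 :+ c) :* (x :+ σ))) refl c x σ ⟩
    c * (suc c * (x + σ)) ∎)
    where
    open ≤-Reasoning
    open +-*-Solver
    C : ∀ {k} → Polynomial k → Polynomial k → Polynomial k
    C m u = con 1 :+ m :+ u

  averaging-drop : ∀ m c x T σ → m < c → c * x ≤ T → suc m * T ≤ c * σ → suc m * (x + T) ≤ suc c * σ
  averaging-drop m c@(suc _) x T σ _ cx≤T mT≤cσ = *-cancelˡ-≤ c (begin
    c * (suc m * (x + T))         ≡⟨ solve 4 (λ m c x T → c :* ((con 1 :+ m) :* (x :+ T))
                                       := (con 1 :+ m) :* (c :* x) :+ c :* ((con 1 :+ m) :* T)) refl m c x T ⟩
    suc m * (c * x) + c * (suc m * T) ≤⟨ +-monoˡ-≤ _ (*-monoʳ-≤ (suc m) cx≤T) ⟩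
    suc m * T + c * (suc m * T)   ≡⟨⟩
    suc c * (suc m * T)           ≤⟨ *-monoʳ-≤ (suc c) mT≤cσ ⟩
    suc c * (c * σ)               ≡⟨ solve 2 (λ c σ → (con 1 :+ c) :* (c :* σ) := c :* ((con 1 :+ c) :* σ)) refl c σ ⟩
    c * (suc c * σ)               ∎)
    where
    open ≤-Reasoning
    open +-*-Solver

  violation⇒n<a+b : ∀ {n D E a b} → 100 * n * E + D * n < D * (a + b) → n < a + b
  violation⇒n<a+b {n} {D} {E} {a} {b} h = *-cancelˡ-< D n (a + b) (≤-<-trans (m≤n+m (D * n) (100 * n * E)) h)

  expansion-contradiction : ∀ {n a b s t D E₀ F P} → a + s ≡ n → b + t ≡ n → s ≤ t → D ≡ E₀ + F + P →
    100 * n * E₀ + D * n < D * (a + b) →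
    4 * n * n * F ≤ D * b * (n + 3 * s) → 4 * n * n * P ≤ D * n * (n + 3 * t) → ⊥
  expansion-contradiction {n} {a} {b} {s} {t} {D} {E₀} {F} a+s≡n b+t≡n s≤t D≡ h₀ hF hP
    with m≤n⇒∃[o]m+o≡n (<⇒≤ (violation⇒n<a+b {n} {D} {E₀} {a} {b} h₀))
  ... | r , n+r≡a+b = excess-contradiction r s t E₀ F _ n≡r+s+t D≡ s≤t h₀′
    (subst (λ x → 4 * n * n * F ≤ D * x * (n + 3 * s)) b≡r+s hF) hP
    where
    b≡r+s : b ≡ r + s
    b≡r+s = +-cancelˡ-≡ a b (r + s) (begin-equality
      a + b         ≡⟨ sym n+r≡a+b ⟩
      n + r         ≡⟨ cong (_+ r) (sym a+s≡n) ⟩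
      a + s + r     ≡⟨ +-assoc a s r ⟩
      a + (s + r)   ≡⟨ cong (a +_) (+-comm s r) ⟩
      a + (r + s)   ∎)
      where open ≤-Reasoning
    n≡r+s+t : n ≡ r + s + t
    n≡r+s+t = trans (sym b+t≡n) (cong (_+ t) b≡r+s)
    h₀′ : 100 * n * E₀ < D * r
    h₀′ = +-cancelˡ-< (D * n) _ _ (subst₂ _<_ (+-comm (100 * n * E₀) (D * n))
            (trans (cong (D *_) (sym n+r≡a+b)) (*-distribˡ-+ D n r)) h₀)

module EdgeCounts where

  open import Defs
  open NatInequalities using (averaging-keep; averaging-drop)
  open import Data.Bool using (true; false; _∧_; if_then_else_)
  open import Data.Bool.Properties using (∧-assoc; ∧-comm)
  open import Data.Nat
  open import Data.Nat.Properties
  open import Algebra.Properties.CommutativeMonoid.Sum +-0-commutativeMonoid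
    using (sum-syntax; ∑-comm; sum-cong-≗; sum-replicate-zero)
  import Data.Nat.ListAction as List
  open import Data.Fin using (Fin; zero; suc)
  open import Data.Fin.Subset using (Subset; ⊤; ∁; ∣_∣; _⊂_; Nonempty; _∉_)
  open import Data.Fin.Subset.Properties using (∣p∣≤n; ∣∁p∣≡n∸∣p∣; ⊆⊤; ∈⊤)
  open import Data.List using (map; tabulate)
  open import Data.Product using (∃; _×_; _,_)
  open import Data.Sum using (inj₁; inj₂)
  open import Data.Vec using ([]; _∷_; lookup; here; there)
  open import Function using (_∘_; id)
  open import Relation.Nullary using (yes; no)
  open import Relation.Binary.PropositionalEquality

  private variable n : ℕ

  ∣p∣+∣∁p∣≡n : (p : Subset n) → ∣ p ∣ + ∣ ∁ p ∣ ≡ n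
  ∣p∣+∣∁p∣≡n p = trans (cong (∣ p ∣ +_) (∣∁p∣≡n∸∣p∣ p)) (m+[n∸m]≡n (∣p∣≤n p))

  ∣p∣>0⇒Nonempty : (p : Subset n) → 0 < ∣ p ∣ → Nonempty p
  ∣p∣>0⇒Nonempty (true  ∷ p) _ = zero , here
  ∣p∣>0⇒Nonempty (false ∷ p) h with ∣p∣>0⇒Nonempty p h
  ... | x , x∈p = suc x , there x∈p

  ∣p∣<n⇒∃∉ : (p : Subset n) → ∣ p ∣ < n → ∃ λ x → x ∉ p
  ∣p∣<n⇒∃∉ (false ∷ p) _       = zero , λ ()
  ∣p∣<n⇒∃∉ (true  ∷ p) (s≤s h) with ∣p∣<n⇒∃∉ p h
  ... | x , x∉p = suc x , λ { (there x∈p) → x∉p x∈p }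

  ∣p∣<n⇒p⊂⊤ : (p : Subset n) → ∣ p ∣ < n → p ⊂ ⊤
  ∣p∣<n⇒p⊂⊤ p h with ∣p∣<n⇒∃∉ p h
  ... | x , x∉p = ⊆⊤ , x , ∈⊤ , x∉p

  infix 10 _ᵀ
  _ᵀ : BipGraph n → BipGraph n
  (G ᵀ) x y = G y x

  sumList-map-tabulate : ∀ {A : Set} (f : A → ℕ) (g : Fin n → A) →
    List.sum (map f (tabulate g)) ≡ ∑[ i < n ] f (g i)
  sumList-map-tabulate {zero}  f g = refl
  sumList-map-tabulate {suc n} f g = cong (f (g zero) +_) (sumList-map-tabulate f (g ∘ suc))

  e≡∑∑ : ∀ (G : BipGraph n) A B → e G A B ≡ ∑[ x < n ] ∑[ y < n ] boolToℕ (lookup A x ∧ lookup B y ∧ G x y)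
  e≡∑∑ {n} G A B = trans (sumList-map-tabulate (λ x → List.sum (map (entry x) (tabulate id))) id)
                          (sum-cong-≗ λ x → sumList-map-tabulate (entry x) id)
    where
    entry : Fin n → Fin n → ℕ
    entry x y = boolToℕ (lookup A x ∧ lookup B y ∧ G x y)

  e-ᵀ : ∀ (G : BipGraph n) A B → e (G ᵀ) B A ≡ e G A B
  e-ᵀ {n} G A B = begin
    e (G ᵀ) B A                                                   ≡⟨ e≡∑∑ (G ᵀ) B A ⟩
    ∑[ y < n ] ∑[ x < n ] boolToℕ (lookup B y ∧ lookup A x ∧ G x y) ≡⟨ ∑-comm (λ y x → boolToℕ (lookup B y ∧ lookup A x ∧ G x y)) ⟩
    ∑[ x < n ] ∑[ y < n ] boolToℕ (lookup B y ∧ lookup A x ∧ G x y) ≡⟨ sum-cong-≗ (λ x → sum-cong-≗ (λ y →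
                                                                        cong boolToℕ (∧-swap (lookup B y) (lookup A x) (G x y)))) ⟩
    ∑[ x < n ] ∑[ y < n ] boolToℕ (lookup A x ∧ lookup B y ∧ G x y) ≡⟨ e≡∑∑ G A B ⟨
    e G A B                                                       ∎
    where
    open ≡-Reasoning
    ∧-swap : ∀ a b c → a ∧ b ∧ c ≡ b ∧ a ∧ c
    ∧-swap a b c = trans (sym (∧-assoc a b c)) (trans (cong (_∧ c) (∧-comm a b)) (∧-assoc b a c))

  degree : BipGraph n → Subset n → Fin n → ℕ
  degree {n} G B x = ∑[ y < n ] boolToℕ (lookup B y ∧ G x y)

  sumOn : Subset n → (Fin n → ℕ) → ℕ
  sumOn {n} A w = ∑[ x < n ] (if lookup A x then w x else 0)

  e≡sumOn-degree : ∀ (G : BipGraph n) A B → e G A B ≡ sumOn A (degree G B)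
  e≡sumOn-degree {n} G A B = trans (e≡∑∑ G A B) (sum-cong-≗ row)
    where
    row : ∀ x → ∑[ y < n ] boolToℕ (lookup A x ∧ lookup B y ∧ G x y) ≡ (if lookup A x then degree G B x else 0)
    row x with lookup A x
    ... | true  = refl
    ... | false = sum-replicate-zero n

  sumOn-∁ : ∀ (A : Subset n) w → sumOn A w + sumOn (∁ A) w ≡ sumOn ⊤ w
  sumOn-∁ []          w = refl
  sumOn-∁ (true  ∷ A) w = trans (+-assoc (w zero) _ _) (cong (w zero +_) (sumOn-∁ A (w ∘ suc)))
  sumOn-∁ (false ∷ A) w = trans (x+[y+z]≡y+[x+z] (sumOn A (w ∘ suc)) (w zero) _) (cong (w zero +_) (sumOn-∁ A (w ∘ suc)))
    where
    x+[y+z]≡y+[x+z] : ∀ x y z → x + (y + z) ≡ y + (x + z)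
    x+[y+z]≡y+[x+z] x y z = trans (sym (+-assoc x y z)) (trans (cong (_+ z) (+-comm x y)) (+-assoc y x z))

  sumOn-∅ : ∀ (A : Subset n) w → ∣ A ∣ ≡ 0 → sumOn A w ≡ 0
  sumOn-∅ []          w _ = refl
  sumOn-∅ (false ∷ A) w h = sumOn-∅ A (w ∘ suc) h

  e-∁ˡ : ∀ (G : BipGraph n) A B → e G A B + e G (∁ A) B ≡ e G ⊤ B
  e-∁ˡ G A B rewrite e≡sumOn-degree G A B | e≡sumOn-degree G (∁ A) B | e≡sumOn-degree G ⊤ B = sumOn-∁ A (degree G B)

  e-∁ʳ : ∀ (G : BipGraph n) A B → e G A B + e G A (∁ B) ≡ e G A ⊤
  e-∁ʳ G A B rewrite sym (e-ᵀ G A B) | sym (e-ᵀ G A (∁ B)) | sym (e-ᵀ G A ⊤) = e-∁ˡ (G ᵀ) B A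

  e-∅ˡ : ∀ (G : BipGraph n) A B → ∣ A ∣ ≡ 0 → e G A B ≡ 0
  e-∅ˡ G A B h = trans (e≡sumOn-degree G A B) (sumOn-∅ A _ h)

  -- Induction on C: keep its first element if that element's weight is at least the average
  -- weight of the rest, and drop it otherwise.
  averaging : ∀ (w : Fin n → ℕ) (C : Subset n) m → m ≤ ∣ C ∣ →
              ∃ λ S → ∣ S ∣ ≡ m × m * sumOn C w ≤ ∣ C ∣ * sumOn S w
  averaging w []          .0 z≤n = [] , refl , z≤n
  averaging w (false ∷ C) m m≤c with averaging (w ∘ suc) C m m≤c
  ... | S , ∣S∣≡m , avg = false ∷ S , ∣S∣≡m , avg
  averaging w (true ∷ C) zero _ with averaging (w ∘ suc) C zero z≤n
  ... | S , ∣S∣≡0 , _ = false ∷ S , ∣S∣≡0 , z≤n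
  averaging w (true ∷ C) (suc m) (s≤s m≤c) with m≤n⇒m<n∨m≡n m≤c
  ... | inj₂ refl = true ∷ C , refl , ≤-refl
  ... | inj₁ m<c with sumOn C (w ∘ suc) ≤? ∣ C ∣ * w zero
  ...   | yes rest≤ with averaging (w ∘ suc) C m m≤c
  ...     | S , ∣S∣≡m , avg = true ∷ S , cong suc ∣S∣≡m , averaging-keep m ∣ C ∣ (w zero) _ _ m<c rest≤ avg
  averaging w (true ∷ C) (suc m) (s≤s m≤c) | inj₁ m<c | no rest≰ with averaging (w ∘ suc) C (suc m) m<c
  ...     | S , ∣S∣≡m , avg = false ∷ S , ∣S∣≡m , averaging-drop m ∣ C ∣ (w zero) _ _ m<c (<⇒≤ (≰⇒> rest≰)) avg

  column-averaging : ∀ (G : BipGraph n) X Y m → m ≤ ∣ Y ∣ →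
                     ∃ λ S → ∣ S ∣ ≡ m × m * e G X Y ≤ ∣ Y ∣ * e G X S
  column-averaging G X Y m m≤∣Y∣ with averaging (degree (G ᵀ) X) Y m m≤∣Y∣
  ... | S , ∣S∣≡m , avg = S , ∣S∣≡m , subst₂ (λ u v → m * u ≤ ∣ Y ∣ * v) (as-columns Y) (as-columns S) avg
    where
    as-columns : ∀ Z → sumOn Z (degree (G ᵀ) X) ≡ e G X Z
    as-columns Z = trans (sym (e≡sumOn-degree (G ᵀ) Z X)) (e-ᵀ G X Z)

module Dichotomy where

  open import Defs
  open Fraction using (ratio-power-≤; ratio-expansion-≤)
  open NatInequalities using (fourth-power-bound; violation⇒n<a+b; expansion-contradiction)
  open EdgeCounts
  open import Data.Nat
  open import Data.Nat.Properties
  open import Data.Fin.Subset using (Subset; ⊤; ∁; _⊂_; Nonempty; ∣_∣)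
  open import Data.Fin.Subset.Properties using (∣p∣≤n; ∣⊤∣≡n; anySubset?; nonempty?; _⊂?_)
  open import Data.Product using (_×_; ∃₂; _,_)
  open import Data.Sum using (_⊎_; inj₁; inj₂)
  open import Data.Empty using (⊥-elim)
  open import Data.Integer using (+_)
  import Data.Rational as ℚ
  import Data.Rational.Properties as ℚ
  open import Relation.Nullary using (¬_; Dec; yes; no; contradiction)
  open import Relation.Nullary.Decidable using (_×-dec_)
  open import Relation.Binary.PropositionalEquality

  private variable n : ℕ

  DenseSquare : (n : ℕ) → BipGraph n → Set
  DenseSquare n G = ∃₂ λ (X′ Y′ : Subset n) →
    Nonempty X′ × X′ ⊂ ⊤ × Nonempty Y′ × Y′ ⊂ ⊤ × ∣ X′ ∣ ≡ ∣ Y′ ∣ ×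
    ((dens G ⊤ ⊤ ^ℚ 4) ℚ.* ratio n ∣ Y′ ∣ ℚ.≤ dens G X′ Y′ ^ℚ 4)

  denseSquare? : (n : ℕ) (G : BipGraph n) → Dec (DenseSquare n G)
  denseSquare? n G = anySubset? λ X′ → anySubset? λ Y′ →
    nonempty? X′ ×-dec X′ ⊂? ⊤ ×-dec nonempty? Y′ ×-dec Y′ ⊂? ⊤ ×-dec ∣ X′ ∣ ≟ ∣ Y′ ∣ ×-dec
    (dens G ⊤ ⊤ ^ℚ 4) ℚ.* ratio n ∣ Y′ ∣ ℚ.≤? dens G X′ Y′ ^ℚ 4

  -- The failure of (i) for a pair of size m = |X| = |Y|, with denominators cleared:
  -- (E/m²)⁴ < (D/n²)⁴ · n/m  ⟺  E⁴ n⁷ < D⁴ m⁷.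
  SparseSquares : BipGraph n → Set
  SparseSquares {n} G = ∀ X Y → ∣ Y ∣ ≡ ∣ X ∣ → 0 < ∣ X ∣ → ∣ X ∣ < n →
    e G X Y ^ 4 * n ^ 7 < e G ⊤ ⊤ ^ 4 * ∣ X ∣ ^ 7

  dens-⊤ : ∀ (G : BipGraph n) → dens G ⊤ ⊤ ≡ ratio (e G ⊤ ⊤) (n * n)
  dens-⊤ {n} G = cong (λ k → ratio (e G ⊤ ⊤) (k * k)) (∣⊤∣≡n n)

  ¬dense⇒sparse : ∀ (G : BipGraph n) → ¬ DenseSquare n G → SparseSquares G
  ¬dense⇒sparse {n} G ¬dense X Y ∣Y∣≡∣X∣ ∣X∣>0 ∣X∣<n
    with e G ⊤ ⊤ ^ 4 * ∣ X ∣ ^ 7 ≤? e G X Y ^ 4 * n ^ 7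
  ... | no  sparse = ≰⇒> sparse
  ... | yes dense  = contradiction
    ( X , Y , ∣p∣>0⇒Nonempty X ∣X∣>0 , ∣p∣<n⇒p⊂⊤ X ∣X∣<n
    , ∣p∣>0⇒Nonempty Y (subst (0 <_) (sym ∣Y∣≡∣X∣) ∣X∣>0) , ∣p∣<n⇒p⊂⊤ Y (subst (_< n) (sym ∣Y∣≡∣X∣) ∣X∣<n)
    , sym ∣Y∣≡∣X∣
    , subst₂ (λ d k → d ^ℚ 4 ℚ.* ratio n k ℚ.≤ ratio (e G X Y) (∣ X ∣ * k) ^ℚ 4) (sym (dens-⊤ G)) (sym ∣Y∣≡∣X∣)
        (ratio-power-≤ n ∣ X ∣ (e G ⊤ ⊤) (e G X Y) dense))
    ¬dense
    where
    instance
      n≢0 : NonZero n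
      n≢0 = >-nonZero (≤-<-trans z≤n ∣X∣<n)
      ∣X∣≢0 : NonZero ∣ X ∣
      ∣X∣≢0 = >-nonZero ∣X∣>0

  sparse-ᵀ : ∀ (G : BipGraph n) → SparseSquares G → SparseSquares (G ᵀ)
  sparse-ᵀ {n} G sparse X Y ∣Y∣≡∣X∣ ∣X∣>0 ∣X∣<n
    rewrite e-ᵀ G Y X | e-ᵀ G ⊤ ⊤ = subst (λ k → e G Y X ^ 4 * n ^ 7 < e G ⊤ ⊤ ^ 4 * k ^ 7) ∣Y∣≡∣X∣
      (sparse Y X (sym ∣Y∣≡∣X∣) (subst (0 <_) (sym ∣Y∣≡∣X∣) ∣X∣>0) (subst (_< n) (sym ∣Y∣≡∣X∣) ∣X∣<n))

  sparse⇒e≤ : ∀ (G : BipGraph n) → SparseSquares G → ∀ X Y → ∣ X ∣ < n → ∣ X ∣ ≤ ∣ Y ∣ →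
    4 * n * n * e G X Y ≤ e G ⊤ ⊤ * ∣ Y ∣ * (n + 3 * ∣ X ∣)
  sparse⇒e≤ {n} G sparse X Y ∣X∣<n ∣X∣≤∣Y∣ with ∣ X ∣ in ∣X∣≡m
  ... | zero = ≤-trans (≤-reflexive (trans (cong (4 * n * n *_) (e-∅ˡ G X Y ∣X∣≡m)) (*-zeroʳ (4 * n * n)))) z≤n
  ... | m@(suc _) with column-averaging G X Y m ∣X∣≤∣Y∣
  ...   | S , ∣S∣≡m , avg = fourth-power-bound n m ∣ Y ∣ (e G X Y) (e G X S) (e G ⊤ ⊤) avg (<⇒≤ sparse-XS)
    where
    sparse-XS : e G X S ^ 4 * n ^ 7 < e G ⊤ ⊤ ^ 4 * m ^ 7
    sparse-XS = subst (λ k → e G X S ^ 4 * n ^ 7 < e G ⊤ ⊤ ^ 4 * k ^ 7) ∣X∣≡m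
      (sparse X S (trans ∣S∣≡m (sym ∣X∣≡m)) (subst (0 <_) (sym ∣X∣≡m) z<s) (subst (_< n) (sym ∣X∣≡m) ∣X∣<n))

  sparse⇒expansion-∣∁A∣≤∣∁B∣ : ∀ (G : BipGraph n) → SparseSquares G → SparseSquares (G ᵀ) →
    ∀ A B → ∣ ∁ A ∣ ≤ ∣ ∁ B ∣ → e G ⊤ ⊤ * (∣ A ∣ + ∣ B ∣) ≤ 100 * n * e G A B + e G ⊤ ⊤ * n
  sparse⇒expansion-∣∁A∣≤∣∁B∣ {n} G sparse sparseᵀ A B s≤t
    with e G ⊤ ⊤ * (∣ A ∣ + ∣ B ∣) ≤? 100 * n * e G A B + e G ⊤ ⊤ * n
  ... | yes expanding = expanding
  ... | no  violated  = ⊥-elim (expansion-contradiction (∣p∣+∣∁p∣≡n A) (∣p∣+∣∁p∣≡n B) s≤t D≡ violation hF hP)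
    where
    violation : 100 * n * e G A B + e G ⊤ ⊤ * n < e G ⊤ ⊤ * (∣ A ∣ + ∣ B ∣)
    violation = ≰⇒> violated
    n<a+b : n < ∣ A ∣ + ∣ B ∣
    n<a+b = violation⇒n<a+b {n} {e G ⊤ ⊤} {e G A B} {∣ A ∣} {∣ B ∣} violation
    s<b : ∣ ∁ A ∣ < ∣ B ∣
    s<b = +-cancelˡ-< ∣ A ∣ _ _ (subst (_< ∣ A ∣ + ∣ B ∣) (sym (∣p∣+∣∁p∣≡n A)) n<a+b)
    t<a : ∣ ∁ B ∣ < ∣ A ∣
    t<a = +-cancelˡ-< ∣ B ∣ _ _ (subst₂ _<_ (sym (∣p∣+∣∁p∣≡n B)) (+-comm ∣ A ∣ ∣ B ∣) n<a+b)
    t<n : ∣ ∁ B ∣ < n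
    t<n = <-≤-trans t<a (∣p∣≤n A)
    D≡ : e G ⊤ ⊤ ≡ e G A B + e G (∁ A) B + e G ⊤ (∁ B)
    D≡ = trans (sym (e-∁ʳ G ⊤ B)) (cong (_+ e G ⊤ (∁ B)) (sym (e-∁ˡ G A B)))
    hF : 4 * n * n * e G (∁ A) B ≤ e G ⊤ ⊤ * ∣ B ∣ * (n + 3 * ∣ ∁ A ∣)
    hF = sparse⇒e≤ G sparse (∁ A) B (<-≤-trans s<b (∣p∣≤n B)) (<⇒≤ s<b)
    hP : 4 * n * n * e G ⊤ (∁ B) ≤ e G ⊤ ⊤ * n * (n + 3 * ∣ ∁ B ∣)
    hP = subst₂ (λ P D → 4 * n * n * P ≤ D * n * (n + 3 * ∣ ∁ B ∣)) (e-ᵀ G ⊤ (∁ B)) (e-ᵀ G ⊤ ⊤)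
           (subst (λ k → 4 * n * n * e (G ᵀ) (∁ B) ⊤ ≤ e (G ᵀ) ⊤ ⊤ * k * (n + 3 * ∣ ∁ B ∣)) (∣⊤∣≡n n)
             (sparse⇒e≤ (G ᵀ) sparseᵀ (∁ B) ⊤ t<n (subst (∣ ∁ B ∣ ≤_) (sym (∣⊤∣≡n n)) (<⇒≤ t<n))))

  sparse⇒expansion : ∀ (G : BipGraph n) → SparseSquares G → SparseSquares (G ᵀ) →
    ∀ A B → e G ⊤ ⊤ * (∣ A ∣ + ∣ B ∣) ≤ 100 * n * e G A B + e G ⊤ ⊤ * n
  sparse⇒expansion {n} G sparse sparseᵀ A B with ≤-total ∣ ∁ A ∣ ∣ ∁ B ∣
  ... | inj₁ s≤t = sparse⇒expansion-∣∁A∣≤∣∁B∣ G sparse sparseᵀ A B s≤t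
  ... | inj₂ t≤s = begin
    e G ⊤ ⊤ * (∣ A ∣ + ∣ B ∣)               ≡⟨ cong₂ _*_ (sym (e-ᵀ G ⊤ ⊤)) (+-comm ∣ A ∣ ∣ B ∣) ⟩
    e (G ᵀ) ⊤ ⊤ * (∣ B ∣ + ∣ A ∣)           ≤⟨ sparse⇒expansion-∣∁A∣≤∣∁B∣ (G ᵀ) sparseᵀ sparse B A t≤s ⟩
    100 * n * e (G ᵀ) B A + e (G ᵀ) ⊤ ⊤ * n ≡⟨ cong₂ (λ E D → 100 * n * E + D * n) (e-ᵀ G A B) (e-ᵀ G ⊤ ⊤) ⟩
    100 * n * e G A B + e G ⊤ ⊤ * n         ∎
    where open ≤-Reasoning

  Expanding : (n : ℕ) → BipGraph n → Set
  Expanding n G = (A B : Subset n) →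
    dens G ⊤ ⊤ ℚ.* ((+ n) ℚ./ 100) ℚ.* ℕtoℚ ∣ A ∣ ℚ.+ dens G ⊤ ⊤ ℚ.* ((+ n) ℚ./ 100) ℚ.* ℕtoℚ ∣ B ∣
      ℚ.≤ dens G ⊤ ⊤ ℚ.* ((+ n) ℚ./ 100) ℚ.* ℕtoℚ n ℚ.+ ℕtoℚ (e G A B)

  dichotomy : ∀ n .{{_ : NonZero n}} (G : BipGraph n) → DenseSquare n G ⊎ Expanding n G
  dichotomy n G with denseSquare? n G
  ... | yes dense  = inj₁ dense
  ... | no  ¬dense = inj₂ λ A B → ratio-expansion-≤ n (e G ⊤ ⊤) (e G A B) ∣ A ∣ ∣ B ∣ (dens-⊤ G)
    (sparse⇒expansion G sparse (sparse-ᵀ G sparse) A B)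
    where
    sparse : SparseSquares G
    sparse = ¬dense⇒sparse G ¬dense

open import Defs
open import Data.Nat using (ℕ; zero; suc)
open import Data.Fin.Subset using (Subset; ⊤; _⊂_; Nonempty; ∣_∣)
open import Data.Product using (_×_; ∃₂)
open import Data.Sum using (_⊎_)
open import Data.Integer using (+_)
open import Data.Rational using (_≤_; _<_; 0ℚ; _*_; _+_; _/_)
open import Data.Rational.Properties using (<-irrefl)
open import Data.Empty using (⊥-elim)
open import Relation.Binary.PropositionalEquality using (_≡_; refl)
open Dichotomy

lemma3p5 : (n : ℕ) (G : BipGraph n) →
  0ℚ < dens G ⊤ ⊤ →
  (∃₂ λ (X′ Y′ : Subset n) →
      Nonempty X′ × X′ ⊂ ⊤ × Nonempty Y′ × Y′ ⊂ ⊤ × ∣ X′ ∣ ≡ ∣ Y′ ∣ ×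
      ((dens G ⊤ ⊤ ^ℚ 4) * ratio n ∣ Y′ ∣ ≤ dens G X′ Y′ ^ℚ 4))
  ⊎
  ((A B : Subset n) →
      ((dens G ⊤ ⊤ * ((+ n) / 100)) * ℕtoℚ (∣ A ∣)) + ((dens G ⊤ ⊤ * ((+ n) / 100)) * ℕtoℚ (∣ B ∣))
        ≤ ((dens G ⊤ ⊤ * ((+ n) / 100)) * ℕtoℚ n) + ℕtoℚ (e G A B))
lemma3p5 zero    G 0<d = ⊥-elim (<-irrefl refl 0<d)   -- for n = 0 the density is the junk value 0
lemma3p5 (suc n) G _   = dichotomy (suc n) G
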